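{- Let $G$ be a finite simple graph with minimum degree $\delta \ge 1$. Let $u$ and $v$ be non-adjacent vertices of $G$ such that $d(u)=\delta<\min_{u'\in N(u)} d(u')$ and $d(v)=\delta<\min_{v'\in N(v)} d(v')$. Then $\mathcal{HSO}(G+uv)<\mathcal{HSO}(G)$.
   Context: For a vertex $w$ of a graph $G$, $d(w)=d_G(w)$ is its degree and $N(w)$ is the set of vertices adjacent to $w$. The hyperbolic Sombor index of a graph $G$ with edge set $E(G)$ is $\mathcal{HSO}(G)=\sum_{xy\in E(G)} \frac{\sqrt{d(x)^2+d(y)^2}}{\min\{d(x),d(y)\}}$. For non-adjacent vertices $u,v$ of $G$, $G+uv$ denotes the graph obtained from $G$ by adding the edge $uv$. -}

module Defs where

open import Data.Bool using (Bool; true; false; if_then_else_; _∧_; _∨_)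
open import Data.Nat as ℕ using (ℕ; _⊓_; _<ᵇ_)
open import Data.Fin using (Fin; toℕ; _≟_)
open import Data.List using (List; []; _∷_; map; concatMap; foldr)
open import Data.Nat.ListAction using (sum)
open import Data.List.Relation.Binary.Pointwise using (Pointwise)
open import Data.Product using (_×_; _,_; ∃; proj₁; proj₂)
open import Data.Sum using (_⊎_)
open import Data.Integer using (+_)
open import Data.Rational using (ℚ; 0ℚ; _/_; _+_; _*_; _≤_; _<_)
open import Relation.Binary.PropositionalEquality using (_≡_; _≢_)
open import Relation.Nullary.Decidable using (⌊_⌋)
open import Data.List using (allFin)

record Graph (n : ℕ) : Set where
  field
    adj  : Fin n → Fin n → Bool
    sym  : ∀ i j → adj i j ≡ adj j i
    irr  : ∀ i → adj i i ≡ false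
open Graph public

Adj : ∀ {n} → Graph n → Fin n → Fin n → Set
Adj G x y = adj G x y ≡ true


-- degree d_G(w) = number of neighbours of w
-- (degrees, edges and HSO are defined for any adjacency matrix; they are
-- applied to adj G and to addEdge G u v)
AdjMat : ℕ → Set
AdjMat n = Fin n → Fin n → Bool

deg : ∀ {n} → AdjMat n → Fin n → ℕ
deg {n} a w = sum (map (λ x → if a w x then 1 else 0) (allFin n))

edges : ∀ {n} → AdjMat n → List (Fin n × Fin n)
edges {n} a =
  concatMap (λ x → concatMap (λ y → if (toℕ x <ᵇ toℕ y) ∧ a x y
                                      then (x , y) ∷ [] else [])
                             (allFin n))
            (allFin n)

addEdge : ∀ {n} → Graph n → Fin n → Fin n → AdjMat n
addEdge G u v x y =
  adj G x y ∨ (⌊ x ≟ u ⌋ ∧ ⌊ y ≟ v ⌋) ∨ (⌊ x ≟ v ⌋ ∧ ⌊ y ≟ u ⌋)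

-- Real numbers of the form  sqrt(A) / m  (A, m natural numbers, m ≥ 1)
-- are represented by the pair (A , m).  The edge term of the hyperbolic
-- Sombor index for the edge xy is sqrt(d(x)^2 + d(y)^2) / min{d(x),d(y)}.
hsoTerms : ∀ {n} → AdjMat n → List (ℕ × ℕ)
hsoTerms a = map (λ e → term (proj₁ e) (proj₂ e)) (edges a)
  where
  term : _ → _ → ℕ × ℕ
  term x y = (deg a x ℕ.* deg a x ℕ.+ deg a y ℕ.* deg a y , deg a x ⊓ deg a y)

ℕtoℚ : ℕ → ℚ
ℕtoℚ k = + k / 1

StrictUpper : ℕ × ℕ → ℚ → Set
StrictUpper (A , m) q = (0ℚ ≤ q) × (ℕtoℚ A < q * q * ℕtoℚ (m ℕ.* m))

StrictLower : ℕ × ℕ → ℚ → Set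
StrictLower (A , m) q = (q < 0ℚ) ⊎ (q * q * ℕtoℚ (m ℕ.* m) < ℕtoℚ A)

sumℚ : List ℚ → ℚ
sumℚ = foldr _+_ 0ℚ

-- Strict order of the real numbers  Σ_i sqrt(A_i)/m_i  <  Σ_j sqrt(B_j)/k_j,
-- via the (open) rational cuts of the summands: the left sum is strictly
-- smaller iff there are rationals strictly above each left summand and
-- strictly below each right summand with (sum of the former) ≤ (sum of the latter).
SqrtSum< : List (ℕ × ℕ) → List (ℕ × ℕ) → Set
SqrtSum< xs ys =
  ∃ λ (us : List ℚ) → ∃ λ (ls : List ℚ) →
    Pointwise StrictUpper xs us × Pointwise StrictLower ys ls × (sumℚ us ≤ sumℚ ls)


HSO< : ∀ {n} → AdjMat n → AdjMat n → Set
HSO< a b = SqrtSum< (hsoTerms a) (hsoTerms b)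

{-# OPTIONS --safe #-}
module Submission where

-- Adding uv raises d(u) = d(v) = δ to δ + 1 and leaves all other degrees alone, so apart
-- from the new term √2 only the 2δ terms of the edges uw and vw change, from √(δ² + d²)/δ
-- to √((δ+1)² + d²)/(δ+1), where d = d(w) ≥ δ + 1. Each of them drops by more than √2/(2δ);
-- squaring and Cauchy–Schwarz reduce this to the polynomial inequality
--   (2δ+1)(2δ((δ+1)² + d²) + 2(δ+1)²) + 2d² ≤ 4(δ² + d²)(δ+1)²    (d ≥ δ + 1).
-- The real sums are compared through rationals: for one scale c, every term √A/m lies
-- strictly between (k - 1)/c and (k + 1)/c, where k = ⌊c√A/m⌋. The rounding errors, 2/c
-- per edge, are charged to the changed edges, and c is taken so large that the slack 2d²
-- above, which scales like c², absorbs them.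

module Arithmetic where
  open import Data.Nat
  open import Data.Nat.Properties
  open import Data.Nat.Tactic.RingSolver using (solve)
  open import Data.List using ([]; _∷_)
  open import Data.Product using (_,_)
  open import Data.Sum using ([_,_]′)
  open import Relation.Binary.PropositionalEquality
  open import Relation.Nullary using (yes; no; contradiction)
  open ≤-Reasoning

  ≤-by-excess : ∀ {m n} k → m + k ≡ n → m ≤ n
  ≤-by-excess k refl = m≤m+n _ k

  *-self-cancel-≤ : ∀ {m n} → m * m ≤ n * n → m ≤ n
  *-self-cancel-≤ {m} {n} h with m ≤? n
  ... | yes m≤n = m≤n
  ... | no m≰n  = contradiction h (<⇒≱ (*-mono-< (≰⇒> m≰n) (≰⇒> m≰n)))

  *-self-cancel-< : ∀ {m n} → m * m < n * n → m < n
  *-self-cancel-< {m} {n} h with m <? n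
  ... | yes m<n = m<n
  ... | no m≮n  = contradiction h (≤⇒≯ (*-mono-≤ (≮⇒≥ m≮n) (≮⇒≥ m≮n)))

  2mn≤m²+n² : ∀ m n → 2 * (m * n) ≤ m * m + n * n
  2mn≤m²+n² m n = [ ordered , flipped ]′ (≤-total m n)
    where
    ordered : ∀ {m n} → m ≤ n → 2 * (m * n) ≤ m * m + n * n
    ordered {m} m≤n with m≤n⇒∃[o]m+o≡n m≤n
    ... | t , refl = ≤-by-excess (t * t) (solve (m ∷ t ∷ []))
    flipped : n ≤ m → 2 * (m * n) ≤ m * m + n * n
    flipped n≤m = subst₂ _≤_ (cong (2 *_) (*-comm n m)) (+-comm (n * n) (m * m)) (ordered n≤m)

  cauchy-schwarz : ∀ a x y → (a * x + y) * (a * x + y) ≤ suc a * (a * (x * x) + y * y)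
  cauchy-schwarz a x y = begin
    (a * x + y) * (a * x + y)                       ≡⟨ solve (a ∷ x ∷ y ∷ []) ⟩
    a * (a * (x * x)) + y * y + a * (2 * (x * y))   ≤⟨ +-monoʳ-≤ _ (*-monoʳ-≤ a (2mn≤m²+n² x y)) ⟩
    a * (a * (x * x)) + y * y + a * (x * x + y * y) ≡⟨ solve (a ∷ x ∷ y ∷ []) ⟩
    suc a * (a * (x * x) + y * y)                   ∎

  square-slack : ∀ {a k g x} → a * a + g < x * x → 2 * a * k + k * k ≤ g → a + k < x
  square-slack {a} {k} {g} {x} gap slack = *-self-cancel-< (begin-strict
    (a + k) * (a + k)           ≡⟨ solve (a ∷ k ∷ []) ⟩
    a * a + (2 * a * k + k * k) ≤⟨ +-monoʳ-≤ (a * a) slack ⟩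
    a * a + g                   <⟨ gap ⟩
    x * x                       ∎)

  gain-polynomial : ∀ {D d} → suc D ≤ d →
    suc (2 * D) * (2 * D * (suc D * suc D + d * d) + 2 * (suc D * suc D)) + 2 * (d * d)
      ≤ 4 * (D * D + d * d) * (suc D * suc D)
  gain-polynomial {D} {d} s≤d = +-cancelʳ-≤ ((6 * D + 2) * (d * d)) _ _ (begin
    suc (2 * D) * (2 * D * (suc D * suc D + d * d) + 2 * (suc D * suc D)) + 2 * (d * d)
      + (6 * D + 2) * (d * d)
      ≡⟨ solve (D ∷ d ∷ []) ⟩
    4 * (D * D + d * d) * (suc D * suc D) + (6 * D + 2) * (suc D * suc D)
      ≤⟨ +-monoʳ-≤ _ (*-monoʳ-≤ (6 * D + 2) (*-mono-≤ s≤d s≤d)) ⟩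
    4 * (D * D + d * d) * (suc D * suc D) + (6 * D + 2) * (d * d) ∎)

  scaled-gain : ∀ {D d c P q r} → suc D ≤ d →
    (D * D + d * d) * c * c < suc P * suc P * (D * D) →
    q * q ≤ (suc D * suc D + d * d) * (c * c) →
    r * r ≤ 2 * (suc D * suc D) * (c * c) →
    (2 * D * q + r) * (2 * D * q + r) + 2 * (d * d) * (c * c)
      < (2 * D * suc P * suc D) * (2 * D * suc P * suc D)
  scaled-gain {D} {d} {c} {P} {q} {r} s≤d hP hq hr = begin-strict
    (2 * D * q + r) * (2 * D * q + r) + 2 * (d * d) * (c * c)
      ≤⟨ +-monoˡ-≤ _ (cauchy-schwarz (2 * D) q r) ⟩
    suc (2 * D) * (2 * D * (q * q) + r * r) + 2 * (d * d) * (c * c)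
      ≤⟨ +-monoˡ-≤ _ (*-monoʳ-≤ (suc (2 * D)) (+-mono-≤ (*-monoʳ-≤ (2 * D) hq) hr)) ⟩
    suc (2 * D) * (2 * D * ((suc D * suc D + d * d) * (c * c)) + 2 * (suc D * suc D) * (c * c))
      + 2 * (d * d) * (c * c)
      ≡⟨ solve (D ∷ d ∷ c ∷ []) ⟩
    (suc (2 * D) * (2 * D * (suc D * suc D + d * d) + 2 * (suc D * suc D)) + 2 * (d * d)) * (c * c)
      ≤⟨ *-monoˡ-≤ (c * c) (gain-polynomial s≤d) ⟩
    4 * (D * D + d * d) * (suc D * suc D) * (c * c)
      ≡⟨ solve (D ∷ d ∷ c ∷ []) ⟩
    4 * (suc D * suc D) * ((D * D + d * d) * c * c)
      <⟨ *-monoʳ-< (4 * (suc D * suc D)) hP ⟩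
    4 * (suc D * suc D) * (suc P * suc P * (D * D))
      ≡⟨ solve (D ∷ P ∷ []) ⟩
    (2 * D * suc P * suc D) * (2 * D * suc P * suc D) ∎

  scaled-slack : ∀ {D d c k q r} → 1 ≤ D → 1 ≤ d → 12 * D * k ≤ c →
    q ≤ 2 * (d * c) → r ≤ 2 * (d * c) →
    2 * (2 * D * q + r) * k + k * k ≤ 2 * (d * d) * (c * c)
  scaled-slack {D} {d} {c} {k} {q} {r} 1≤D 1≤d c-large q≤ r≤ = begin
    2 * (2 * D * q + r) * k + k * k
      ≤⟨ +-mono-≤ (*-monoˡ-≤ k (*-monoʳ-≤ 2 (+-mono-≤ (*-monoʳ-≤ (2 * D) q≤) r≤))) (*-mono-≤ k≤c k≤c) ⟩
    2 * (2 * D * (2 * (d * c)) + 2 * (d * c)) * k + c * c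
      ≡⟨ solve (D ∷ d ∷ c ∷ k ∷ []) ⟩
    (4 + 8 * D) * k * (d * c) + c * c
      ≤⟨ +-mono-≤ (*-monoˡ-≤ (d * c) (≤-trans weighted-k≤c c≤dc)) (*-mono-≤ c≤dc c≤dc) ⟩
    d * c * (d * c) + d * c * (d * c)
      ≡⟨ solve (d ∷ c ∷ []) ⟩
    2 * (d * d) * (c * c) ∎
    where
    weighted-k≤c : (4 + 8 * D) * k ≤ c
    weighted-k≤c = begin
      (4 + 8 * D) * k     ≤⟨ *-monoˡ-≤ k (+-monoˡ-≤ (8 * D) (*-monoʳ-≤ 4 1≤D)) ⟩
      (4 * D + 8 * D) * k ≡⟨ solve (D ∷ k ∷ []) ⟩
      12 * D * k          ≤⟨ c-large ⟩
      c                   ∎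
    k≤c : k ≤ c
    k≤c = ≤-trans (m≤n*m k (4 + 8 * D)) weighted-k≤c
    c≤dc : c ≤ d * c
    c≤dc = m≤n*m c d {{>-nonZero 1≤d}}

  -- P, Q and R are the scaled floors of √(D² + d²)/D, √((D+1)² + d²)/(D+1) and
  -- √(2(D+1)²)/(D+1): an old edge term at u, the same edge after adding uv, and the new edge.
  -- After multiplying by D + 1, square-slack splits the claim into scaled-gain and scaled-slack.
  floor-gain : ∀ {D d c K P Q R} → 1 ≤ D → suc D ≤ d → 12 * D * ((K + 2 * D) * suc D) ≤ c →
    (D * D + d * d) * c * c < suc P * suc P * (D * D) →
    Q * Q * (suc D * suc D) ≤ (suc D * suc D + d * d) * c * c →
    R * R * (suc D * suc D) ≤ (suc D * suc D + suc D * suc D) * c * c →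
    2 * D * Q + (R + K) ≤ 2 * D * P
  floor-gain {D} {d} {c} {K} {P} {Q} {R} 1≤D s≤d c-large hP hQ hR =
    <⇒≤ (+-cancelʳ-< (2 * D) _ _ (*-cancelʳ-< (suc D) _ _ (begin-strict
      (2 * D * Q + (R + K) + 2 * D) * suc D
        ≡⟨ solve (D ∷ Q ∷ R ∷ K ∷ []) ⟩
      (2 * D * (Q * suc D) + R * suc D) + (K + 2 * D) * suc D
        <⟨ square-slack {a = 2 * D * (Q * suc D) + R * suc D} gain slack ⟩
      2 * D * suc P * suc D
        ≡⟨ solve (D ∷ P ∷ []) ⟩
      (2 * D * P + 2 * D) * suc D ∎)))
    where
    hq : Q * suc D * (Q * suc D) ≤ (suc D * suc D + d * d) * (c * c)
    hq = begin
      Q * suc D * (Q * suc D)           ≡⟨ solve (Q ∷ D ∷ []) ⟩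
      Q * Q * (suc D * suc D)           ≤⟨ hQ ⟩
      (suc D * suc D + d * d) * c * c   ≡⟨ solve (D ∷ d ∷ c ∷ []) ⟩
      (suc D * suc D + d * d) * (c * c) ∎

    hr : R * suc D * (R * suc D) ≤ 2 * (suc D * suc D) * (c * c)
    hr = begin
      R * suc D * (R * suc D)                 ≡⟨ solve (R ∷ D ∷ []) ⟩
      R * R * (suc D * suc D)                 ≤⟨ hR ⟩
      (suc D * suc D + suc D * suc D) * c * c ≡⟨ solve (D ∷ c ∷ []) ⟩
      2 * (suc D * suc D) * (c * c)           ∎

    ≤2dc : ∀ {y e} → y * y ≤ e * (c * c) → e ≤ 4 * (d * d) → y ≤ 2 * (d * c)
    ≤2dc {y} {e} h e≤ = *-self-cancel-≤ (begin
      y * y                       ≤⟨ h ⟩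
      e * (c * c)                 ≤⟨ *-monoˡ-≤ (c * c) e≤ ⟩
      4 * (d * d) * (c * c)       ≡⟨ solve (d ∷ c ∷ []) ⟩
      2 * (d * c) * (2 * (d * c)) ∎)

    s²≤d² : suc D * suc D ≤ d * d
    s²≤d² = *-mono-≤ s≤d s≤d

    gain : (2 * D * (Q * suc D) + R * suc D) * (2 * D * (Q * suc D) + R * suc D) + 2 * (d * d) * (c * c)
           < (2 * D * suc P * suc D) * (2 * D * suc P * suc D)
    gain = scaled-gain s≤d hP hq hr

    slack : 2 * (2 * D * (Q * suc D) + R * suc D) * ((K + 2 * D) * suc D)
              + (K + 2 * D) * suc D * ((K + 2 * D) * suc D) ≤ 2 * (d * d) * (c * c)
    slack = scaled-slack 1≤D (≤-trans (s≤s z≤n) s≤d) c-large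
      (≤2dc hq (begin
        suc D * suc D + d * d ≤⟨ +-monoˡ-≤ (d * d) s²≤d² ⟩
        d * d + d * d         ≤⟨ ≤-by-excess (2 * (d * d)) (solve (d ∷ [])) ⟩
        4 * (d * d)           ∎))
      (≤2dc hr (begin
        2 * (suc D * suc D)   ≤⟨ *-monoʳ-≤ 2 s²≤d² ⟩
        2 * (d * d)           ≤⟨ ≤-by-excess (2 * (d * d)) (solve (d ∷ [])) ⟩
        4 * (d * d)           ∎))

  round-apart-≤ : ∀ {D P Q X} → 1 ≤ P → 2 * D * Q + X ≤ 2 * D * P →
    2 * D * suc Q + X ≤ 2 * D * pred P + 4 * D
  round-apart-≤ {D} {suc P} {Q} {X} _ h = begin
    2 * D * suc Q + X     ≡⟨ solve (D ∷ Q ∷ X ∷ []) ⟩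
    2 * D * Q + X + 2 * D ≤⟨ +-monoˡ-≤ (2 * D) h ⟩
    2 * D * suc P + 2 * D ≡⟨ solve (D ∷ P ∷ []) ⟩
    2 * D * P + 4 * D     ∎

  round-apart-same : ∀ D {P} → 1 ≤ P → 2 * D * suc P ≤ 2 * D * pred P + 4 * D
  round-apart-same D {suc P} _ = begin
    2 * D * suc (suc P) ≡⟨ solve (D ∷ P ∷ []) ⟩
    2 * D * P + 4 * D   ∎

module ScaledRoots where
  open import Data.Nat
  open import Data.Nat.Properties
  open import Data.Product using (_×_; _,_)
  open import Relation.Binary.PropositionalEquality
  open import Relation.Nullary using (yes; no; contradiction)
  open ≤-Reasoning

  rootBelow : ℕ → ℕ → ℕ → ℕ
  rootBelow q N zero = zero
  rootBelow q N (suc b) with suc b * suc b * q ≤? N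
  ... | yes _ = suc b
  ... | no _  = rootBelow q N b

  rootBelow-sound : ∀ q N b → rootBelow q N b * rootBelow q N b * q ≤ N
  rootBelow-sound q N zero = z≤n
  rootBelow-sound q N (suc b) with suc b * suc b * q ≤? N
  ... | yes fits = fits
  ... | no _     = rootBelow-sound q N b

  rootBelow-maximal : ∀ q N b → N < suc b * suc b * q →
    N < suc (rootBelow q N b) * suc (rootBelow q N b) * q
  rootBelow-maximal q N zero    above = above
  rootBelow-maximal q N (suc b) above with suc b * suc b * q ≤? N
  ... | yes _      = above
  ... | no too-big = rootBelow-maximal q N b (≰⇒> too-big)

  -- ⌊ c √A / m ⌋, for the term (A , m) that stands for √A / m.
  scaledRoot : ℕ → ℕ × ℕ → ℕ
  scaledRoot c (A , m) = rootBelow (m * m) (A * c * c) (A * c * c)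

  scaledRoot-sound : ∀ c A m → scaledRoot c (A , m) * scaledRoot c (A , m) * (m * m) ≤ A * c * c
  scaledRoot-sound c A m = rootBelow-sound (m * m) (A * c * c) (A * c * c)

  scaledRoot-above : ∀ c A m → 1 ≤ m →
    A * c * c < suc (scaledRoot c (A , m)) * suc (scaledRoot c (A , m)) * (m * m)
  scaledRoot-above c A m 1≤m = rootBelow-maximal (m * m) N N (begin-strict
    N                       <⟨ n<1+n N ⟩
    suc N                   ≤⟨ m≤m*n (suc N) (suc N) ⟩
    suc N * suc N           ≤⟨ m≤m*n (suc N * suc N) (m * m) {{>-nonZero (*-mono-≤ 1≤m 1≤m)}} ⟩
    suc N * suc N * (m * m) ∎)
    where
    N : ℕ
    N = A * c * c

  scaledRoot-positive : ∀ c A m → 1 ≤ c → 1 ≤ m → m * m ≤ A → 1 ≤ scaledRoot c (A , m)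
  scaledRoot-positive c A m 1≤c 1≤m m²≤A with scaledRoot c (A , m) | scaledRoot-above c A m 1≤m
  ... | suc _ | _     = s≤s z≤n
  ... | zero  | above = contradiction above (≤⇒≯ (begin
    1 * 1 * (m * m) ≡⟨ *-identityˡ (m * m) ⟩
    m * m           ≤⟨ m²≤A ⟩
    A               ≤⟨ m≤m*n A c {{>-nonZero 1≤c}} ⟩
    A * c           ≤⟨ m≤m*n (A * c) c {{>-nonZero 1≤c}} ⟩
    A * c * c       ∎))

  pred-square-< : ∀ {k n} → 1 ≤ k → 1 ≤ n → pred k * pred k * n < k * k * n
  pred-square-< {suc k} {n} _ 1≤n = *-monoˡ-< n {{>-nonZero 1≤n}} (*-mono-< (n<1+n k) (n<1+n k))

module RationalCuts where
  open import Data.Nat as ℕ using (ℕ; suc)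
  import Data.Nat.Properties as ℕ
  open import Data.Nat.Coprimality using (1-coprimeTo) renaming (sym to coprime-sym)
  import Data.Integer as ℤ
  import Data.Integer.Properties as ℤ
  open import Data.Rational
  open import Data.Rational.Properties
  open import Data.Rational.Literals using (fromℤ)
  open import Data.Rational.Solver using (module +-*-Solver)
  open import Data.List using ([]; _∷_; map)
  open import Data.List.Relation.Unary.All as All using (All; []; _∷_)
  open import Data.List.Relation.Binary.Pointwise using (Pointwise; []; _∷_)
  open import Data.Nat.ListAction using (sum)
  open import Data.Product using (_×_; _,_; proj₁; proj₂)
  open import Data.Sum using (inj₂)
  open import Function using (_∘_)
  open import Relation.Binary.PropositionalEquality
  open import Defs using (ℕtoℚ; StrictUpper; StrictLower; SqrtSum<; sumℚ)
  open ScaledRoots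

  ℕtoℚ≡fromℤ : ∀ k → ℕtoℚ k ≡ fromℤ (ℤ.+ k)
  ℕtoℚ≡fromℤ k = normalize-coprime (coprime-sym (1-coprimeTo k))

  ℕtoℚ-+ : ∀ a b → ℕtoℚ (a ℕ.+ b) ≡ ℕtoℚ a + ℕtoℚ b
  ℕtoℚ-+ a b rewrite ℕtoℚ≡fromℤ a | ℕtoℚ≡fromℤ b =
    cong (_/ 1) (trans (ℤ.pos-+ a b) (sym (cong₂ ℤ._+_ (ℤ.*-identityʳ (ℤ.+ a)) (ℤ.*-identityʳ (ℤ.+ b)))))

  ℕtoℚ-* : ∀ a b → ℕtoℚ (a ℕ.* b) ≡ ℕtoℚ a * ℕtoℚ b
  ℕtoℚ-* a b rewrite ℕtoℚ≡fromℤ a | ℕtoℚ≡fromℤ b = cong (_/ 1) (ℤ.pos-* a b)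

  ℕtoℚ-mono-≤ : ∀ {a b} → a ℕ.≤ b → ℕtoℚ a ≤ ℕtoℚ b
  ℕtoℚ-mono-≤ {a} {b} a≤b rewrite ℕtoℚ≡fromℤ a | ℕtoℚ≡fromℤ b =
    *≤* (subst₂ ℤ._≤_ (sym (ℤ.*-identityʳ (ℤ.+ a))) (sym (ℤ.*-identityʳ (ℤ.+ b))) (ℤ.+≤+ a≤b))

  ℕtoℚ-mono-< : ∀ {a b} → a ℕ.< b → ℕtoℚ a < ℕtoℚ b
  ℕtoℚ-mono-< {a} {b} a<b rewrite ℕtoℚ≡fromℤ a | ℕtoℚ≡fromℤ b =
    *<* (subst₂ ℤ._<_ (sym (ℤ.*-identityʳ (ℤ.+ a))) (sym (ℤ.*-identityʳ (ℤ.+ b))) (ℤ.+<+ a<b))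

  module AtScale (c₀ : ℕ) where

    c : ℕ
    c = suc c₀

    cℚ ε : ℚ
    cℚ = fromℤ (ℤ.+ c)
    ε  = 1/ cℚ

    atScale : ℕ → ℚ
    atScale k = ℕtoℚ k * ε

    atScale-square : ∀ k n → atScale k * atScale k * ℕtoℚ n * (cℚ * cℚ) ≡ ℕtoℚ (k ℕ.* k ℕ.* n)
    atScale-square k n = begin
      ℕtoℚ k * ε * (ℕtoℚ k * ε) * ℕtoℚ n * (cℚ * cℚ)
        ≡⟨ rearrange (ℕtoℚ k) (ℕtoℚ n) ε cℚ ⟩
      ℕtoℚ k * ℕtoℚ k * ℕtoℚ n * (ε * cℚ * (ε * cℚ))
        ≡⟨ cong (λ e → ℕtoℚ k * ℕtoℚ k * ℕtoℚ n * (e * e)) (*-inverseˡ cℚ) ⟩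
      ℕtoℚ k * ℕtoℚ k * ℕtoℚ n * (1ℚ * 1ℚ)
        ≡⟨ *-identityʳ _ ⟩
      ℕtoℚ k * ℕtoℚ k * ℕtoℚ n
        ≡⟨ trans (ℕtoℚ-* (k ℕ.* k) n) (cong (_* ℕtoℚ n) (ℕtoℚ-* k k)) ⟨
      ℕtoℚ (k ℕ.* k ℕ.* n) ∎
      where
      open ≡-Reasoning
      open +-*-Solver
      rearrange : ∀ x y e d → x * e * (x * e) * y * (d * d) ≡ x * x * y * (e * d * (e * d))
      rearrange = solve 4 (λ x y e d → x :* e :* (x :* e) :* y :* (d :* d)
                                   := x :* x :* y :* (e :* d :* (e :* d))) refl

    scale-square : ∀ A → ℕtoℚ A * (cℚ * cℚ) ≡ ℕtoℚ (A ℕ.* c ℕ.* c)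
    scale-square A = begin
      ℕtoℚ A * (cℚ * cℚ)       ≡⟨ *-assoc (ℕtoℚ A) cℚ cℚ ⟨
      ℕtoℚ A * cℚ * cℚ         ≡⟨ cong (λ x → ℕtoℚ A * x * x) (ℕtoℚ≡fromℤ c) ⟨
      ℕtoℚ A * ℕtoℚ c * ℕtoℚ c ≡⟨ trans (ℕtoℚ-* (A ℕ.* c) c) (cong (_* ℕtoℚ c) (ℕtoℚ-* A c)) ⟨
      ℕtoℚ (A ℕ.* c ℕ.* c)     ∎
      where open ≡-Reasoning

    atScale-nonNeg : ∀ k → 0ℚ ≤ atScale k
    atScale-nonNeg k = subst (_≤ atScale k) (*-zeroˡ ε) (*-monoʳ-≤-nonNeg ε (ℕtoℚ-mono-≤ {0} {k} ℕ.z≤n))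

    atScale-upper : ∀ A m k → A ℕ.* c ℕ.* c ℕ.< k ℕ.* k ℕ.* (m ℕ.* m) → StrictUpper (A , m) (atScale k)
    atScale-upper A m k below = atScale-nonNeg k ,
      *-cancelʳ-<-nonNeg (cℚ * cℚ) {{nonNeg*nonNeg⇒nonNeg cℚ cℚ}}
        (subst₂ _<_ (sym (scale-square A)) (sym (atScale-square k (m ℕ.* m))) (ℕtoℚ-mono-< below))

    atScale-lower : ∀ A m k → k ℕ.* k ℕ.* (m ℕ.* m) ℕ.< A ℕ.* c ℕ.* c → StrictLower (A , m) (atScale k)
    atScale-lower A m k above = inj₂
      (*-cancelʳ-<-nonNeg (cℚ * cℚ) {{nonNeg*nonNeg⇒nonNeg cℚ cℚ}}
        (subst₂ _<_ (sym (atScale-square k (m ℕ.* m))) (sym (scale-square A)) (ℕtoℚ-mono-< above)))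

    sumℚ-atScale : ∀ {E : Set} (f : E → ℕ) L → sumℚ (map (atScale ∘ f) L) ≡ atScale (sum (map f L))
    sumℚ-atScale f []      = sym (*-zeroˡ ε)
    sumℚ-atScale f (t ∷ L) = begin
      atScale (f t) + sumℚ (map (atScale ∘ f) L)   ≡⟨ cong (atScale (f t) +_) (sumℚ-atScale f L) ⟩
      atScale (f t) + atScale (sum (map f L))      ≡⟨ *-distribʳ-+ ε (ℕtoℚ (f t)) _ ⟨
      (ℕtoℚ (f t) + ℕtoℚ (sum (map f L))) * ε      ≡⟨ cong (_* ε) (ℕtoℚ-+ (f t) _) ⟨
      atScale (f t ℕ.+ sum (map f L))              ∎
      where open ≡-Reasoning

  Term≥1 : ℕ × ℕ → Set
  Term≥1 t = 1 ℕ.≤ proj₂ t × proj₂ t ℕ.* proj₂ t ℕ.≤ proj₁ t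

  All⇒Pointwise-map : ∀ {A B : Set} {R : A → B → Set} {f : A → B} {xs} →
    All (λ x → R x (f x)) xs → Pointwise R xs (map f xs)
  All⇒Pointwise-map []       = []
  All⇒Pointwise-map (r ∷ rs) = r ∷ All⇒Pointwise-map rs

  SqrtSum<-byScaledRoots : ∀ c₀ {xs ys} → All (λ t → 1 ℕ.≤ proj₂ t) xs → All Term≥1 ys →
    sum (map (suc ∘ scaledRoot (suc c₀)) xs) ℕ.≤ sum (map (ℕ.pred ∘ scaledRoot (suc c₀)) ys) →
    SqrtSum< xs ys
  SqrtSum<-byScaledRoots c₀ {xs} {ys} xs-ok ys-ok sum≤ =
    map (atScale ∘ above) xs , map (atScale ∘ below) ys ,
    All⇒Pointwise-map (All.map (λ {t} → upper {t}) xs-ok) ,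
    All⇒Pointwise-map (All.map (λ {t} → lower {t}) ys-ok) ,
    subst₂ _≤_ (sym (sumℚ-atScale above xs)) (sym (sumℚ-atScale below ys))
      (*-monoʳ-≤-nonNeg ε (ℕtoℚ-mono-≤ sum≤))
    where
    open AtScale c₀
    above below : ℕ × ℕ → ℕ
    above = suc ∘ scaledRoot c
    below = ℕ.pred ∘ scaledRoot c
    upper : ∀ {t} → 1 ℕ.≤ proj₂ t → StrictUpper t (atScale (above t))
    upper {A , m} 1≤m = atScale-upper A m (above (A , m)) (scaledRoot-above c A m 1≤m)
    lower : ∀ {t} → Term≥1 t → StrictLower t (atScale (below t))
    lower {A , m} (1≤m , m²≤A) = atScale-lower A m (below (A , m)) (ℕ.<-≤-trans
      (pred-square-< (scaledRoot-positive c A m (ℕ.s≤s ℕ.z≤n) 1≤m m²≤A) (ℕ.*-mono-≤ 1≤m 1≤m))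
      (scaledRoot-sound c A m))

module FinSums where
  open import Data.Nat hiding (_≟_)
  open import Data.Nat.Properties hiding (_≟_)
  open import Data.Nat.ListAction using (sum)
  open import Data.Nat.ListAction.Properties using (sum-++)
  open import Data.Fin using (Fin; zero; suc; toℕ; _≟_)
  import Data.Fin.Properties as Fin
  open import Data.List using (List; []; _∷_; map; concatMap; tabulate; _++_)
  open import Data.List.Properties using (map-++)
  open import Data.Bool using (Bool; true; false; if_then_else_; _∨_)
  open import Function using (_∘_)
  open import Relation.Binary.PropositionalEquality
  open import Relation.Nullary using (contradiction)
  open import Relation.Nullary.Decidable using (⌊_⌋; isYes≗does; dec-true; dec-false)
  open import Relation.Nullary.Reflects using (ofʸ; ofⁿ)
  open import Algebra.Properties.Semiring.Sum +-*-semiring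
    using (sum-syntax; ∑-distrib-+; ∑-comm; sum-cong-≗; *-distribˡ-sum; sum-replicate-zero)
    renaming (sum to ∑)
  open ≡-Reasoning

  I : Bool → ℕ
  I b = if b then 1 else 0

  ∑∑ : ∀ {n} → (Fin n → Fin n → ℕ) → ℕ
  ∑∑ {n} f = ∑[ x < n ] ∑[ y < n ] f x y

  ∑-mono-≤ : ∀ {n} {f g : Fin n → ℕ} → (∀ x → f x ≤ g x) → ∑ f ≤ ∑ g
  ∑-mono-≤ {zero}  f≤g = z≤n
  ∑-mono-≤ {suc n} f≤g = +-mono-≤ (f≤g zero) (∑-mono-≤ (f≤g ∘ suc))

  ∑-single : ∀ {n} (f : Fin n → ℕ) p → (∀ x → x ≢ p → f x ≡ 0) → ∑ f ≡ f p
  ∑-single {suc n} f zero off = begin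
    f zero + ∑ (f ∘ suc)     ≡⟨ cong (f zero +_) (sum-cong-≗ (λ x → off (suc x) λ ())) ⟩
    f zero + ∑ {n} (λ _ → 0) ≡⟨ cong (f zero +_) (sum-replicate-zero n) ⟩
    f zero + 0               ≡⟨ +-identityʳ (f zero) ⟩
    f zero                   ∎
  ∑-single {suc n} f (suc p) off = begin
    f zero + ∑ (f ∘ suc) ≡⟨ cong (_+ ∑ (f ∘ suc)) (off zero λ ()) ⟩
    ∑ (f ∘ suc)
      ≡⟨ ∑-single (f ∘ suc) p (λ x x≢p → off (suc x) (x≢p ∘ Fin.suc-injective)) ⟩
    f (suc p)            ∎

  ≟-refl : ∀ {n} (x : Fin n) → ⌊ x ≟ x ⌋ ≡ true
  ≟-refl x = trans (isYes≗does (x ≟ x)) (dec-true (x ≟ x) refl)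

  ≟-≢ : ∀ {n} {x y : Fin n} → x ≢ y → ⌊ x ≟ y ⌋ ≡ false
  ≟-≢ {x = x} {y} x≢y = trans (isYes≗does (x ≟ y)) (dec-false (x ≟ y) x≢y)

  ∑-δ : ∀ {n} (p : Fin n) (f : Fin n → ℕ) → ∑[ x < n ] (I ⌊ x ≟ p ⌋ * f x) ≡ f p
  ∑-δ p f = begin
    ∑ (λ x → I ⌊ x ≟ p ⌋ * f x)
      ≡⟨ ∑-single _ p (λ x x≢p → cong (λ b → I b * f x) (≟-≢ x≢p)) ⟩
    I ⌊ p ≟ p ⌋ * f p           ≡⟨ cong (λ b → I b * f p) (≟-refl p) ⟩
    1 * f p                     ≡⟨ *-identityˡ (f p) ⟩
    f p                         ∎

  ∑-indicator : ∀ {n} (p : Fin n) → ∑[ x < n ] I ⌊ x ≟ p ⌋ ≡ 1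
  ∑-indicator p = trans (sum-cong-≗ (λ x → sym (*-identityʳ (I ⌊ x ≟ p ⌋)))) (∑-δ p (λ _ → 1))

  ∑∑-cong : ∀ {n} {f g : Fin n → Fin n → ℕ} → (∀ x y → f x y ≡ g x y) → ∑∑ f ≡ ∑∑ g
  ∑∑-cong f≗g = sum-cong-≗ (λ x → sum-cong-≗ (f≗g x))

  ∑∑-mono-≤ : ∀ {n} {f g : Fin n → Fin n → ℕ} → (∀ x y → f x y ≤ g x y) → ∑∑ f ≤ ∑∑ g
  ∑∑-mono-≤ f≤g = ∑-mono-≤ (λ x → ∑-mono-≤ (f≤g x))

  ∑∑-distrib-+ : ∀ {n} (f g : Fin n → Fin n → ℕ) → ∑∑ (λ x y → f x y + g x y) ≡ ∑∑ f + ∑∑ g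
  ∑∑-distrib-+ f g =
    trans (sum-cong-≗ (λ x → ∑-distrib-+ (f x) (g x))) (∑-distrib-+ (λ x → ∑ (f x)) (λ x → ∑ (g x)))

  ∑∑-distribˡ-* : ∀ {n} k (f : Fin n → Fin n → ℕ) → k * ∑∑ f ≡ ∑∑ (λ x y → k * f x y)
  ∑∑-distribˡ-* k f = trans (*-distribˡ-sum k (λ x → ∑ (f x))) (sum-cong-≗ (λ x → *-distribˡ-sum k (f x)))

  ∑∑-linear : ∀ {n} p q (f g : Fin n → Fin n → ℕ) →
    ∑∑ (λ x y → p * f x y + q * g x y) ≡ p * ∑∑ f + q * ∑∑ g
  ∑∑-linear p q f g = trans (∑∑-distrib-+ (λ x y → p * f x y) (λ x y → q * g x y))
                            (sym (cong₂ _+_ (∑∑-distribˡ-* p f) (∑∑-distribˡ-* q g)))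

  ∑∑-δ : ∀ {n} (p q : Fin n) (f : Fin n → Fin n → ℕ) →
    ∑∑ (λ x y → I ⌊ x ≟ p ⌋ * I ⌊ y ≟ q ⌋ * f x y) ≡ f p q
  ∑∑-δ p q f = trans (sum-cong-≗ row) (∑-δ p (λ x → f x q))
    where
    row : ∀ x → ∑ (λ y → I ⌊ x ≟ p ⌋ * I ⌊ y ≟ q ⌋ * f x y) ≡ I ⌊ x ≟ p ⌋ * f x q
    row x = begin
      ∑ (λ y → i * I ⌊ y ≟ q ⌋ * f x y)   ≡⟨ sum-cong-≗ (λ y → *-assoc i (I ⌊ y ≟ q ⌋) (f x y)) ⟩
      ∑ (λ y → i * (I ⌊ y ≟ q ⌋ * f x y)) ≡⟨ *-distribˡ-sum i (λ y → I ⌊ y ≟ q ⌋ * f x y) ⟨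
      i * ∑ (λ y → I ⌊ y ≟ q ⌋ * f x y)   ≡⟨ cong (i *_) (∑-δ q (f x)) ⟩
      i * f x q                           ∎
      where
      i : ℕ
      i = I ⌊ x ≟ p ⌋

  I-∨-false : ∀ b → I (b ∨ false) ≡ I b + 0
  I-∨-false true  = refl
  I-∨-false false = refl

  I-*-mono-≤ : ∀ b {m n} → (b ≡ true → m ≤ n) → I b * m ≤ I b * n
  I-*-mono-≤ true  m≤n = *-monoʳ-≤ 1 (m≤n refl)
  I-*-mono-≤ false _   = z≤n

  ∑∑-upper-half : ∀ {n} (f : Fin n → Fin n → ℕ) → (∀ x y → f x y ≡ f y x) → (∀ x → f x x ≡ 0) →
    2 * ∑∑ (λ x y → I (toℕ x <ᵇ toℕ y) * f x y) ≡ ∑∑ f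
  ∑∑-upper-half {n} f f-sym f-diag = begin
    2 * ∑∑ upper                       ≡⟨ cong (∑∑ upper +_) (+-identityʳ _) ⟩
    ∑∑ upper + ∑∑ upper                ≡⟨ cong (∑∑ upper +_) (∑-comm upper) ⟩
    ∑∑ upper + ∑∑ (λ x y → upper y x)  ≡⟨ ∑∑-distrib-+ upper (λ x y → upper y x) ⟨
    ∑∑ (λ x y → upper x y + upper y x) ≡⟨ ∑∑-cong halves ⟩
    ∑∑ f                               ∎
    where
    upper : Fin n → Fin n → ℕ
    upper x y = I (toℕ x <ᵇ toℕ y) * f x y
    halves : ∀ x y → upper x y + upper y x ≡ f x y
    halves x y with toℕ x <ᵇ toℕ y | <ᵇ-reflects-< (toℕ x) (toℕ y)
                  | toℕ y <ᵇ toℕ x | <ᵇ-reflects-< (toℕ y) (toℕ x)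
    ... | true  | ofʸ x<y | true  | ofʸ y<x = contradiction y<x (<-asym x<y)
    ... | true  | _       | false | _       = trans (+-identityʳ _) (*-identityˡ _)
    ... | false | _       | true  | _       = trans (*-identityˡ _) (f-sym y x)
    ... | false | ofⁿ x≮y | false | ofⁿ y≮x with Fin.toℕ-injective (≤-antisym (≮⇒≥ y≮x) (≮⇒≥ x≮y))
    ...   | refl = sym (f-diag x)

  sum-map-tabulate : ∀ {A : Set} {n} (f : A → ℕ) (g : Fin n → A) →
    sum (map f (tabulate g)) ≡ ∑[ i < n ] f (g i)
  sum-map-tabulate {n = zero}  f g = refl
  sum-map-tabulate {n = suc n} f g = cong (f (g zero) +_) (sum-map-tabulate f (g ∘ suc))

  sum-map-concatMap : ∀ {A B : Set} (f : B → ℕ) (g : A → List B) xs →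
    sum (map f (concatMap g xs)) ≡ sum (map (λ x → sum (map f (g x))) xs)
  sum-map-concatMap f g []       = refl
  sum-map-concatMap f g (x ∷ xs) = begin
    sum (map f (g x ++ concatMap g xs))
      ≡⟨ cong sum (map-++ f (g x) _) ⟩
    sum (map f (g x) ++ map f (concatMap g xs))
      ≡⟨ sum-++ (map f (g x)) _ ⟩
    sum (map f (g x)) + sum (map f (concatMap g xs))
      ≡⟨ cong (sum (map f (g x)) +_) (sum-map-concatMap f g xs) ⟩
    sum (map f (g x)) + sum (map (λ x → sum (map f (g x))) xs) ∎

module HSOTerms where
  open import Data.Nat
  open import Data.Nat.Properties
  open import Data.Nat.ListAction using (sum)
  open import Data.Fin using (Fin; toℕ)
  open import Data.List using (List; []; _∷_; map; concatMap; allFin)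
  open import Data.List.Properties using (map-∘)
  import Data.List.Relation.Unary.All as All
  open import Data.List.Relation.Unary.All.Properties using (map⁺)
  open import Data.Bool using (true; false; if_then_else_; _∧_)
  open import Data.Product using (_×_; _,_; proj₁; proj₂)
  open import Relation.Binary.PropositionalEquality
  open import Algebra.Properties.Semiring.Sum +-*-semiring using (sum-syntax; sum-cong-≗) renaming (sum to ∑)
  open import Defs hiding (sym)
  open FinSums
  open RationalCuts using (Term≥1)
  open ≡-Reasoning

  hsoTerm : ℕ → ℕ → ℕ × ℕ
  hsoTerm p q = (p * p + q * q , p ⊓ q)

  hsoTerm-comm : ∀ p q → hsoTerm p q ≡ hsoTerm q p
  hsoTerm-comm p q = cong₂ _,_ (+-comm (p * p) (q * q)) (⊓-comm p q)

  hsoTerm≥1 : ∀ {p q} → 1 ≤ p → 1 ≤ q → Term≥1 (hsoTerm p q)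
  hsoTerm≥1 {p} {q} 1≤p 1≤q =
    ⊓-glb 1≤p 1≤q , ≤-trans (*-mono-≤ (m⊓n≤m p q) (m⊓n≤m p q)) (m≤m+n (p * p) (q * q))

  hsoTerms≥1 : ∀ {n} (b : AdjMat n) → (∀ w → 1 ≤ deg b w) → All.All Term≥1 (hsoTerms b)
  hsoTerms≥1 b deg≥1 = map⁺ (All.universal (λ e → hsoTerm≥1 (deg≥1 (proj₁ e)) (deg≥1 (proj₂ e))) _)

  deg-∑ : ∀ {n} (b : AdjMat n) w → deg b w ≡ ∑[ x < n ] I (b w x)
  deg-∑ b w = sum-map-tabulate (λ x → I (b w x)) (λ x → x)

  sum-edges : ∀ {n} (b : AdjMat n) (f : Fin n → Fin n → ℕ) →
    sum (map (λ e → f (proj₁ e) (proj₂ e)) (edges b))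
      ≡ ∑∑ (λ x y → I (toℕ x <ᵇ toℕ y) * (I (b x y) * f x y))
  sum-edges {n} b f = begin
    sum (map f′ (edges b))
      ≡⟨ sum-map-concatMap f′ row (allFin n) ⟩
    sum (map (λ x → sum (map f′ (row x))) (allFin n))
      ≡⟨ sum-map-tabulate (λ x → sum (map f′ (row x))) (λ x → x) ⟩
    ∑[ x < n ] sum (map f′ (row x))
      ≡⟨ sum-cong-≗ (λ x → trans (sum-map-concatMap f′ (entry x) (allFin n))
                                 (sum-map-tabulate (λ y → sum (map f′ (entry x y))) (λ y → y))) ⟩
    ∑∑ (λ x y → sum (map f′ (entry x y)))
      ≡⟨ ∑∑-cong (λ x y → singleton (toℕ x <ᵇ toℕ y) (b x y)) ⟩
    ∑∑ (λ x y → I (toℕ x <ᵇ toℕ y) * (I (b x y) * f x y)) ∎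
    where
    f′ : Fin n × Fin n → ℕ
    f′ e = f (proj₁ e) (proj₂ e)
    entry : Fin n → Fin n → List (Fin n × Fin n)
    entry x y = if (toℕ x <ᵇ toℕ y) ∧ b x y then (x , y) ∷ [] else []
    row : Fin n → List (Fin n × Fin n)
    row x = concatMap (entry x) (allFin n)
    singleton : ∀ {x y} p q → sum (map f′ (if p ∧ q then (x , y) ∷ [] else [])) ≡ I p * (I q * f x y)
    singleton true  true  = trans (+-identityʳ _) (sym (trans (*-identityˡ _) (*-identityˡ _)))
    singleton true  false = refl
    singleton false q     = refl

  ∑-hsoTerms : ∀ {n} (b : AdjMat n) → (∀ x y → b x y ≡ b y x) → (∀ x → b x x ≡ false) →
    (g : ℕ × ℕ → ℕ) →
    2 * sum (map g (hsoTerms b)) ≡ ∑∑ (λ x y → I (b x y) * g (hsoTerm (deg b x) (deg b y)))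
  ∑-hsoTerms {n} b b-sym b-irr g = begin
    2 * sum (map g (hsoTerms b))
      ≡⟨ cong (λ ts → 2 * sum ts) (map-∘ (edges b)) ⟨
    2 * sum (map (λ e → g (hsoTerm (deg b (proj₁ e)) (deg b (proj₂ e)))) (edges b))
      ≡⟨ cong (2 *_) (sum-edges b (λ x y → g (hsoTerm (deg b x) (deg b y)))) ⟩
    2 * ∑∑ (λ x y → I (toℕ x <ᵇ toℕ y) * edgeTerm x y)
      ≡⟨ ∑∑-upper-half edgeTerm edgeTerm-sym edgeTerm-diag ⟩
    ∑∑ edgeTerm ∎
    where
    edgeTerm : Fin n → Fin n → ℕ
    edgeTerm x y = I (b x y) * g (hsoTerm (deg b x) (deg b y))
    edgeTerm-sym : ∀ x y → edgeTerm x y ≡ edgeTerm y x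
    edgeTerm-sym x y = cong₂ (λ e t → I e * g t) (b-sym x y) (hsoTerm-comm (deg b x) (deg b y))
    edgeTerm-diag : ∀ x → edgeTerm x x ≡ 0
    edgeTerm-diag x = cong (λ e → I e * g (hsoTerm (deg b x) (deg b x))) (b-irr x)

open import Data.Nat using (ℕ; _≤_; _<_)
open import Data.Fin using (Fin)
open import Relation.Binary.PropositionalEquality using (_≡_; _≢_)
open import Relation.Nullary using (¬_)
open import Defs using (Graph; Adj; adj; deg)

module AddEdge {n} (G : Graph n) {u v : Fin n} (u≢v : u ≢ v) (u≁v : ¬ Adj G u v) where
  open import Data.Nat hiding (_≟_)
  open import Data.Nat.Properties hiding (_≟_)
  open import Data.Fin using (_≟_)
  open import Data.Bool using (true; false; _∧_; _∨_)
  open import Data.Bool.Properties using (∨-comm; ∧-comm; ∧-zeroʳ)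
  open import Relation.Binary.PropositionalEquality
  open import Relation.Nullary using (yes; no; contradiction)
  open import Relation.Nullary.Decidable using (⌊_⌋)
  open import Algebra.Properties.Semiring.Sum +-*-semiring
    using (sum-syntax; sum-cong-≗; ∑-distrib-+; ∑-comm; *-distribˡ-sum; *-distribʳ-sum) renaming (sum to ∑)
  open import Defs hiding (sym)
  open FinSums
  open HSOTerms using (deg-∑)
  open ≡-Reasoning

  endpoint : Fin n → ℕ
  endpoint w = I ⌊ w ≟ u ⌋ + I ⌊ w ≟ v ⌋

  adj-uv : adj G u v ≡ false
  adj-uv with adj G u v
  ... | true  = contradiction refl u≁v
  ... | false = refl

  I-addEdge : ∀ x y → I (addEdge G u v x y) ≡
    I (adj G x y) + (I ⌊ x ≟ u ⌋ * I ⌊ y ≟ v ⌋ + I ⌊ x ≟ v ⌋ * I ⌊ y ≟ u ⌋)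
  I-addEdge x y with x ≟ u | x ≟ v
  ... | yes refl | yes u≡v = contradiction u≡v u≢v
  ... | no _     | no _    = I-∨-false (adj G x y)
  ... | yes refl | no _ with y ≟ v
  ...   | yes refl rewrite adj-uv = refl
  ...   | no _     = I-∨-false (adj G u y)
  I-addEdge x y | no _ | yes refl with y ≟ u
  ...   | yes refl rewrite Graph.sym G v u | adj-uv = refl
  ...   | no _     = I-∨-false (adj G v y)

  deg-addEdge : ∀ w → deg (addEdge G u v) w ≡ deg (adj G) w + endpoint w
  deg-addEdge w = begin
    deg (addEdge G u v) w
      ≡⟨ deg-∑ (addEdge G u v) w ⟩
    ∑[ x < n ] I (addEdge G u v w x)
      ≡⟨ sum-cong-≗ (I-addEdge w) ⟩
    ∑[ x < n ] (I (adj G w x) + new-edge x)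
      ≡⟨ ∑-distrib-+ (λ x → I (adj G w x)) new-edge ⟩
    ∑[ x < n ] I (adj G w x) + ∑ new-edge
      ≡⟨ cong₂ _+_ (sym (deg-∑ (adj G) w))
                   (∑-distrib-+ (λ x → U * I ⌊ x ≟ v ⌋) (λ x → V * I ⌊ x ≟ u ⌋)) ⟩
    deg (adj G) w + (∑[ x < n ] (U * I ⌊ x ≟ v ⌋) + ∑[ x < n ] (V * I ⌊ x ≟ u ⌋))
      ≡⟨ cong (deg (adj G) w +_) (cong₂ _+_ (scaled-indicator U v) (scaled-indicator V u)) ⟩
    deg (adj G) w + endpoint w ∎
    where
    U V : ℕ
    U = I ⌊ w ≟ u ⌋
    V = I ⌊ w ≟ v ⌋
    new-edge : Fin n → ℕ
    new-edge x = U * I ⌊ x ≟ v ⌋ + V * I ⌊ x ≟ u ⌋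
    scaled-indicator : ∀ k p → ∑[ x < n ] (k * I ⌊ x ≟ p ⌋) ≡ k
    scaled-indicator k p =
      trans (sym (*-distribˡ-sum k (λ x → I ⌊ x ≟ p ⌋))) (trans (cong (k *_) (∑-indicator p)) (*-identityʳ k))

  ∑∑-addEdge : ∀ (f : Fin n → Fin n → ℕ) →
    ∑∑ (λ x y → I (addEdge G u v x y) * f x y) ≡ ∑∑ (λ x y → I (adj G x y) * f x y) + (f u v + f v u)
  ∑∑-addEdge f = begin
    ∑∑ (λ x y → I (addEdge G u v x y) * f x y)
      ≡⟨ ∑∑-cong split ⟩
    ∑∑ (λ x y → old x y + (new-uv x y + new-vu x y))
      ≡⟨ ∑∑-distrib-+ old (λ x y → new-uv x y + new-vu x y) ⟩
    ∑∑ old + ∑∑ (λ x y → new-uv x y + new-vu x y)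
      ≡⟨ cong (∑∑ old +_) (trans (∑∑-distrib-+ new-uv new-vu) (cong₂ _+_ (∑∑-δ u v f) (∑∑-δ v u f))) ⟩
    ∑∑ old + (f u v + f v u) ∎
    where
    old new-uv new-vu : Fin n → Fin n → ℕ
    old x y    = I (adj G x y) * f x y
    new-uv x y = I ⌊ x ≟ u ⌋ * I ⌊ y ≟ v ⌋ * f x y
    new-vu x y = I ⌊ x ≟ v ⌋ * I ⌊ y ≟ u ⌋ * f x y
    split : ∀ x y → I (addEdge G u v x y) * f x y ≡ old x y + (new-uv x y + new-vu x y)
    split x y rewrite I-addEdge x y =
      trans (*-distribʳ-+ (f x y) (I (adj G x y)) _)
            (cong (old x y +_) (*-distribʳ-+ (f x y) (I ⌊ x ≟ u ⌋ * I ⌊ y ≟ v ⌋) _))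

  addEdge-sym : ∀ x y → addEdge G u v x y ≡ addEdge G u v y x
  addEdge-sym x y = cong₂ _∨_ (Graph.sym G x y) (trans (∨-comm (⌊ x ≟ u ⌋ ∧ ⌊ y ≟ v ⌋) _)
    (cong₂ _∨_ (∧-comm ⌊ x ≟ v ⌋ ⌊ y ≟ u ⌋) (∧-comm ⌊ x ≟ u ⌋ ⌊ y ≟ v ⌋)))

  addEdge-irrefl : ∀ x → addEdge G u v x x ≡ false
  addEdge-irrefl x rewrite Graph.irr G x with x ≟ u
  ... | yes refl rewrite ≟-≢ u≢v = refl
  ... | no _     = ∧-zeroʳ ⌊ x ≟ v ⌋

  ∑∑-endpoint : ∑∑ (λ x y → I (adj G x y) * endpoint x) ≡ deg (adj G) u + deg (adj G) v
  ∑∑-endpoint = begin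
    ∑∑ (λ x y → I (adj G x y) * endpoint x)
      ≡⟨ sum-cong-≗ (λ x → sym (*-distribʳ-sum (endpoint x) (λ y → I (adj G x y)))) ⟩
    ∑[ x < n ] (∑[ y < n ] I (adj G x y) * endpoint x)
      ≡⟨ sum-cong-≗ (λ x → cong (_* endpoint x) (sym (deg-∑ (adj G) x))) ⟩
    ∑[ x < n ] (deg (adj G) x * endpoint x)
      ≡⟨ sum-cong-≗ (λ x → trans (*-distribˡ-+ (deg (adj G) x) (I ⌊ x ≟ u ⌋) _)
                                  (cong₂ _+_ (*-comm (deg (adj G) x) _) (*-comm (deg (adj G) x) _))) ⟩
    ∑[ x < n ] (I ⌊ x ≟ u ⌋ * deg (adj G) x + I ⌊ x ≟ v ⌋ * deg (adj G) x)
      ≡⟨ ∑-distrib-+ (λ x → I ⌊ x ≟ u ⌋ * deg (adj G) x) (λ x → I ⌊ x ≟ v ⌋ * deg (adj G) x) ⟩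
    ∑[ x < n ] (I ⌊ x ≟ u ⌋ * deg (adj G) x) + ∑[ x < n ] (I ⌊ x ≟ v ⌋ * deg (adj G) x)
      ≡⟨ cong₂ _+_ (∑-δ u (deg (adj G))) (∑-δ v (deg (adj G))) ⟩
    deg (adj G) u + deg (adj G) v ∎

  ∑∑-endpoints : ∑∑ (λ x y → I (adj G x y) * (endpoint x + endpoint y)) ≡ 2 * (deg (adj G) u + deg (adj G) v)
  ∑∑-endpoints = begin
    ∑∑ (λ x y → I (adj G x y) * (endpoint x + endpoint y))
      ≡⟨ ∑∑-cong (λ x y → *-distribˡ-+ (I (adj G x y)) (endpoint x) (endpoint y)) ⟩
    ∑∑ (λ x y → at-x x y + at-y x y)
      ≡⟨ ∑∑-distrib-+ at-x at-y ⟩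
    ∑∑ at-x + ∑∑ at-y
      ≡⟨ cong (∑∑ at-x +_) (∑-comm at-y) ⟩
    ∑∑ at-x + ∑∑ (λ y x → at-y x y)
      ≡⟨ cong (∑∑ at-x +_) (∑∑-cong (λ y x → cong (λ b → I b * endpoint y) (Graph.sym G x y))) ⟩
    ∑∑ at-x + ∑∑ at-x
      ≡⟨ cong (λ s → s + s) ∑∑-endpoint ⟩
    (deg (adj G) u + deg (adj G) v) + (deg (adj G) u + deg (adj G) v)
      ≡⟨ cong (deg (adj G) u + deg (adj G) v +_) (+-identityʳ _) ⟨
    2 * (deg (adj G) u + deg (adj G) v) ∎
    where
    at-x at-y : Fin n → Fin n → ℕ
    at-x x y = I (adj G x y) * endpoint x
    at-y x y = I (adj G x y) * endpoint y

module EdgeBudget (D K : ℕ) (1≤D : 1 ≤ D) where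
  open import Data.Nat
  open import Data.Nat.Properties
  open import Data.Product using (_×_; _,_)
  open import Relation.Binary.PropositionalEquality
  open Arithmetic
  open ScaledRoots
  open HSOTerms using (hsoTerm; hsoTerm≥1)

  c₀ : ℕ
  c₀ = 12 * D * ((K + 2 * D) * suc D)

  S : ℕ × ℕ → ℕ
  S = scaledRoot (suc c₀)

  R : ℕ
  R = S (hsoTerm (suc D) (suc D))

  S-positive : ∀ {p q} → 1 ≤ p → 1 ≤ q → 1 ≤ S (hsoTerm p q)
  S-positive {p} {q} 1≤p 1≤q = let (1≤m , m²≤A) = hsoTerm≥1 1≤p 1≤q in
    scaledRoot-positive (suc c₀) (p * p + q * q) (p ⊓ q) (s≤s z≤n) 1≤m m²≤A

  budget-changed : ∀ {d} → suc D ≤ d →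
    2 * D * suc (S (hsoTerm (suc D) d)) + (R + K) ≤ 2 * D * pred (S (hsoTerm D d)) + 4 * D
  budget-changed {d} s≤d = round-apart-≤ {D} (S-positive 1≤D 1≤d)
    (floor-gain {K = K} {P = P} {Q = Q} {R = R} 1≤D s≤d (n≤1+n c₀) hP hQ hR)
    where
    c P Q : ℕ
    c = suc c₀
    P = S (hsoTerm D d)
    Q = S (hsoTerm (suc D) d)
    1≤d : 1 ≤ d
    1≤d = ≤-trans (s≤s z≤n) s≤d
    hP : (D * D + d * d) * c * c < suc P * suc P * (D * D)
    hP = subst (λ m → (D * D + d * d) * c * c < suc P * suc P * (m * m))
               (m≤n⇒m⊓n≡m (≤-trans (n≤1+n D) s≤d))
               (scaledRoot-above c (D * D + d * d) (D ⊓ d) (⊓-glb 1≤D 1≤d))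
    hQ : Q * Q * (suc D * suc D) ≤ (suc D * suc D + d * d) * c * c
    hQ = subst (λ m → Q * Q * (m * m) ≤ (suc D * suc D + d * d) * c * c)
               (m≤n⇒m⊓n≡m s≤d)
               (scaledRoot-sound c (suc D * suc D + d * d) (suc D ⊓ d))
    hR : R * R * (suc D * suc D) ≤ (suc D * suc D + suc D * suc D) * c * c
    hR = subst (λ m → R * R * (m * m) ≤ (suc D * suc D + suc D * suc D) * c * c)
               (⊓-idem (suc D))
               (scaledRoot-sound c (suc D * suc D + suc D * suc D) (suc D ⊓ suc D))

  budget-unchanged : ∀ {p q} → 1 ≤ p → 1 ≤ q →
    2 * D * suc (S (hsoTerm p q)) ≤ 2 * D * pred (S (hsoTerm p q)) + 4 * D
  budget-unchanged 1≤p 1≤q = round-apart-same D (S-positive 1≤p 1≤q)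

module Counting {n} (G : Graph n) {u v : Fin n} (δ≥1 : ∀ w → 1 ≤ deg (adj G) w)
  (u≢v : u ≢ v) (u≁v : ¬ Adj G u v) (deg-u≡deg-v : deg (adj G) u ≡ deg (adj G) v)
  (u-strict : ∀ y → Adj G u y → deg (adj G) u < deg (adj G) y)
  (v-strict : ∀ y → Adj G v y → deg (adj G) v < deg (adj G) y) where
  open import Data.Nat hiding (_≟_)
  open import Data.Nat.Properties hiding (_≟_)
  open import Data.Nat.ListAction using (sum)
  open import Data.Nat.Tactic.RingSolver using (solve; solve-∀)
  open import Data.Fin using (_≟_)
  open import Data.List using (map; []; _∷_)
  import Data.List.Relation.Unary.All as All
  open import Data.Product using (proj₁)
  open import Function using (_∘_)
  open import Relation.Binary.PropositionalEquality
  open import Relation.Nullary using (Dec; yes; no)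
  open import Defs hiding (sym)
  open FinSums
  open HSOTerms
  open AddEdge G u≢v u≁v
  open RationalCuts using (SqrtSum<-byScaledRoots)

  private
    a a⁺ : AdjMat n
    a  = adj G
    a⁺ = addEdge G u v

  D E₂ : ℕ
  D  = deg a u
  E₂ = ∑∑ (λ x y → I (a x y))

  open EdgeBudget D (suc E₂) (δ≥1 u)

  old new : Fin n → Fin n → ℕ
  old x y = pred (S (hsoTerm (deg a x) (deg a y)))
  new x y = suc (S (hsoTerm (deg a⁺ x) (deg a⁺ y)))

  -- In units of 1/(2Dc): an ordered edge xy is allowed 4D for its rounding, and pays
  -- L = R + E₂ + 1 for each of its ends at u or v. The E₂ ordered edges of G have 4D ends
  -- at u or v, which pay 4D·L = 4D·E₂ + 2D·2(R + 1): all the allowances, and the new edge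
  -- counted as uv and as vu.
  Budget : Fin n → Fin n → Set
  Budget x y = 2 * D * new x y + (R + suc E₂) * (endpoint x + endpoint y) ≤ 2 * D * old x y + 4 * D

  budget-flip : ∀ {x y} → Budget x y → Budget y x
  budget-flip {x} {y} budget = begin
    2 * D * new y x + (R + suc E₂) * (endpoint y + endpoint x)
      ≡⟨ cong₂ (λ t κ → 2 * D * suc (S t) + (R + suc E₂) * κ)
               (hsoTerm-comm (deg a⁺ y) (deg a⁺ x)) (+-comm (endpoint y) (endpoint x)) ⟩
    2 * D * new x y + (R + suc E₂) * (endpoint x + endpoint y)
      ≤⟨ budget ⟩
    2 * D * old x y + 4 * D
      ≡⟨ cong (λ t → 2 * D * pred (S t) + 4 * D) (hsoTerm-comm (deg a x) (deg a y)) ⟩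
    2 * D * old y x + 4 * D ∎
    where open ≤-Reasoning

  adj-irrefl : ∀ {x} → ¬ Adj G x x
  adj-irrefl {x} xx with trans (sym xx) (Graph.irr G x)
  ... | ()

  adj-sym : ∀ {x y} → Adj G x y → Adj G y x
  adj-sym {x} {y} xy = trans (Graph.sym G y x) xy

  endpoint-off : ∀ {w} → w ≢ u → w ≢ v → endpoint w ≡ 0
  endpoint-off w≢u w≢v rewrite ≟-≢ w≢u | ≟-≢ w≢v = refl

  record NewEdgeEnd (x : Fin n) : Set where
    field
      deg≡D        : deg a x ≡ D
      endpoint≡1   : endpoint x ≡ 1
      nbr-deg      : ∀ {y} → Adj G x y → suc D ≤ deg a y
      nbr-endpoint : ∀ {y} → Adj G x y → endpoint y ≡ 0

    deg⁺≡1+D : deg a⁺ x ≡ suc D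
    deg⁺≡1+D = trans (deg-addEdge x) (trans (cong₂ _+_ deg≡D endpoint≡1) (+-comm D 1))

  open NewEdgeEnd

  u-end : NewEdgeEnd u
  u-end = record
    { deg≡D        = refl
    ; endpoint≡1   = cong₂ (λ p q → I p + I q) (≟-refl u) (≟-≢ u≢v)
    ; nbr-deg      = u-strict _
    ; nbr-endpoint = λ {y} uy → endpoint-off {y} (λ { refl → adj-irrefl uy }) (λ { refl → u≁v uy })
    }

  v-end : NewEdgeEnd v
  v-end = record
    { deg≡D        = sym deg-u≡deg-v
    ; endpoint≡1   = cong₂ (λ p q → I p + I q) (≟-≢ (u≢v ∘ sym)) (≟-refl v)
    ; nbr-deg      = λ vy → subst (λ k → suc k ≤ _) (sym deg-u≡deg-v) (v-strict _ vy)
    ; nbr-endpoint = λ {y} vy → endpoint-off {y} (λ { refl → u≁v (adj-sym vy) }) (λ { refl → adj-irrefl vy })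
    }

  budget-at-end : ∀ {x y} → NewEdgeEnd x → Adj G x y → Budget x y
  budget-at-end {x} {y} x-end xy
    rewrite deg⁺≡1+D x-end | deg-addEdge y | endpoint≡1 x-end | nbr-endpoint x-end xy | deg≡D x-end
          | +-identityʳ (deg a y) | *-identityʳ (R + suc E₂)
    = budget-changed (nbr-deg x-end xy)

  budget-away : ∀ {x y} → endpoint x ≡ 0 → endpoint y ≡ 0 → Budget x y
  budget-away {x} {y} x-off y-off
    rewrite deg-addEdge x | deg-addEdge y | x-off | y-off
          | +-identityʳ (deg a x) | +-identityʳ (deg a y) | *-zeroʳ (R + suc E₂)
          | +-identityʳ (2 * D * suc (S (hsoTerm (deg a x) (deg a y))))
    = budget-unchanged (δ≥1 x) (δ≥1 y)

  -- The decisions are matched as arguments: a with on x ≟ u would also abstract the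
  -- occurrences of x ≟ u inside addEdge.
  edge-budget : ∀ x y → Adj G x y → Budget x y
  edge-budget x y = by-cases (x ≟ u) (x ≟ v) (y ≟ u) (y ≟ v)
    where
    by-cases : ∀ {x y} → Dec (x ≡ u) → Dec (x ≡ v) → Dec (y ≡ u) → Dec (y ≡ v) → Adj G x y → Budget x y
    by-cases (yes refl) _          _          _          xy = budget-at-end u-end xy
    by-cases (no _)     (yes refl) _          _          xy = budget-at-end v-end xy
    by-cases (no _)     (no _)     (yes refl) _          xy = budget-flip (budget-at-end u-end (adj-sym xy))
    by-cases (no _)     (no _)     (no _)     (yes refl) xy = budget-flip (budget-at-end v-end (adj-sym xy))
    by-cases (no x≢u)   (no x≢v)   (no y≢u)   (no y≢v)   _  =
      budget-away (endpoint-off x≢u x≢v) (endpoint-off y≢u y≢v)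

  summed-budget :
    2 * D * ∑∑ (λ x y → I (a x y) * new x y) + (R + suc E₂) * (2 * (D + D))
      ≤ 2 * D * ∑∑ (λ x y → I (a x y) * old x y) + 4 * D * E₂
  summed-budget = begin
    2 * D * ∑∑ new-terms + L * (2 * (D + D))
      ≡⟨ cong (λ κ → 2 * D * ∑∑ new-terms + L * κ)
              (trans (cong (λ d → 2 * (D + d)) deg-u≡deg-v) (sym ∑∑-endpoints)) ⟩
    2 * D * ∑∑ new-terms + L * ∑∑ endpoint-terms
      ≡⟨ ∑∑-linear (2 * D) L new-terms endpoint-terms ⟨
    ∑∑ (λ x y → 2 * D * new-terms x y + L * endpoint-terms x y)
      ≡⟨ ∑∑-cong (λ x y → pull-indicator (I (a x y)) (2 * D) (new x y) L (endpoint x + endpoint y)) ⟩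
    ∑∑ (λ x y → I (a x y) * (2 * D * new x y + L * (endpoint x + endpoint y)))
      ≤⟨ ∑∑-mono-≤ (λ x y → I-*-mono-≤ (a x y) (edge-budget x y)) ⟩
    ∑∑ (λ x y → I (a x y) * (2 * D * old x y + 4 * D))
      ≡⟨ ∑∑-cong (λ x y → pull-indicator′ (I (a x y)) (2 * D) (old x y) (4 * D)) ⟨
    ∑∑ (λ x y → 2 * D * old-terms x y + 4 * D * I (a x y))
      ≡⟨ ∑∑-linear (2 * D) (4 * D) old-terms (λ x y → I (a x y)) ⟩
    2 * D * ∑∑ old-terms + 4 * D * E₂ ∎
    where
    open ≤-Reasoning
    L : ℕ
    L = R + suc E₂
    new-terms old-terms endpoint-terms : Fin n → Fin n → ℕ
    new-terms x y      = I (a x y) * new x y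
    old-terms x y      = I (a x y) * old x y
    endpoint-terms x y = I (a x y) * (endpoint x + endpoint y)
    pull-indicator : ∀ i p q r s → p * (i * q) + r * (i * s) ≡ i * (p * q + r * s)
    pull-indicator = solve-∀
    pull-indicator′ : ∀ i p q r → p * (i * q) + r * i ≡ i * (p * q + r)
    pull-indicator′ = solve-∀

  ∑new⁺≤∑old : ∑∑ (λ x y → I (a⁺ x y) * new x y) ≤ ∑∑ (λ x y → I (a x y) * old x y)
  ∑new⁺≤∑old = cancel (δ≥1 u) new⁺≡ summed-budget
    where
    new⁺≡ : ∑∑ (λ x y → I (a⁺ x y) * new x y) ≡ ∑∑ (λ x y → I (a x y) * new x y) + (suc R + suc R)
    new⁺≡ = trans (∑∑-addEdge new)
      (cong (∑∑ (λ x y → I (a x y) * new x y) +_)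
            (cong₂ _+_ (cong₂ (λ p q → suc (S (hsoTerm p q))) (deg⁺≡1+D u-end) (deg⁺≡1+D v-end))
                       (cong₂ (λ p q → suc (S (hsoTerm p q))) (deg⁺≡1+D v-end) (deg⁺≡1+D u-end))))
    cancel : ∀ {D N N⁺ O R E} → 1 ≤ D → N⁺ ≡ N + (suc R + suc R) →
      2 * D * N + (R + suc E) * (2 * (D + D)) ≤ 2 * D * O + 4 * D * E → N⁺ ≤ O
    cancel {D} {N} {_} {O} {R} {E} 1≤D refl h =
      *-cancelˡ-≤ (2 * D) {{>-nonZero (≤-trans 1≤D (m≤n*m D 2))}} (+-cancelʳ-≤ (4 * D * E) _ _ (begin
        2 * D * (N + (suc R + suc R)) + 4 * D * E ≡⟨ solve (D ∷ N ∷ R ∷ E ∷ []) ⟩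
        2 * D * N + (R + suc E) * (2 * (D + D))   ≤⟨ h ⟩
        2 * D * O + 4 * D * E                     ∎))
      where open ≤-Reasoning

  HSO<-addEdge : HSO< (addEdge G u v) (adj G)
  HSO<-addEdge = SqrtSum<-byScaledRoots c₀
    (All.map proj₁ (hsoTerms≥1 a⁺ δ⁺≥1))
    (hsoTerms≥1 a δ≥1)
    (*-cancelˡ-≤ 2 (begin
      2 * sum (map (suc ∘ S) (hsoTerms a⁺)) ≡⟨ ∑-hsoTerms a⁺ addEdge-sym addEdge-irrefl (suc ∘ S) ⟩
      ∑∑ (λ x y → I (a⁺ x y) * new x y)     ≤⟨ ∑new⁺≤∑old ⟩
      ∑∑ (λ x y → I (a x y) * old x y)      ≡⟨ ∑-hsoTerms a (Graph.sym G) (Graph.irr G) (pred ∘ S) ⟨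
      2 * sum (map (pred ∘ S) (hsoTerms a)) ∎))
    where
    open ≤-Reasoning
    δ⁺≥1 : ∀ w → 1 ≤ deg a⁺ w
    δ⁺≥1 w = ≤-trans (δ≥1 w) (≤-trans (m≤m+n _ _) (≤-reflexive (sym (deg-addEdge w))))

open import Defs
open import Data.Nat.Properties using (≤-antisym)

proposition2 : ∀ {n} (G : Graph n) (u v : Fin n) →
    (∀ w → 1 ≤ deg (adj G) w) →
    u ≢ v → ¬ Adj G u v →
    (∀ w → deg (adj G) u ≤ deg (adj G) w) →
    (∀ u′ → Adj G u u′ → deg (adj G) u < deg (adj G) u′) →
    (∀ w → deg (adj G) v ≤ deg (adj G) w) →
    (∀ v′ → Adj G v v′ → deg (adj G) v < deg (adj G) v′) →
    HSO< (addEdge G u v) (adj G)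
proposition2 G u v δ≥1 u≢v u≁v u-min u-strict v-min v-strict =
  Counting.HSO<-addEdge G δ≥1 u≢v u≁v (≤-antisym (u-min v) (v-min u)) u-strict v-strict
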